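{- Let $k\ge 0$ and $n,m\ge k+5$. Then $\mathrm{f}\mu^{k}(K_m\times K_n)=mn-4-k$.
   Context: For an integer $k\ge 0$ and a connected graph $G$, a set $X\subseteq V(G)$ is a $k$-fault-tolerant mutual-visibility set ($k$-ftmv set) if for any two non-adjacent vertices $u,v\in X$ there exist $k+1$ internally vertex-disjoint shortest $u,v$-paths $Q_1,\dots,Q_{k+1}$ in $G$ such that $V(Q_i)\cap X=\{u,v\}$ for every $i$. $\mathrm{f}\mu^{k}(G)$ denotes the maximum cardinality of a $k$-ftmv set of $G$. $K_n$ is the complete graph on $n$ vertices and $G\times H$ is the direct product: vertex set $V(G)\times V(H)$, with $(g,h)\sim(g',h')$ iff $gg'\in E(G)$ and $hh'\in E(H)$. -}

module Defs where

open import Level using (0ℓ)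
open import Data.Nat using (ℕ; zero; suc; _≤_)
open import Data.Fin using (Fin)
open import Data.List using (List; []; _∷_; length)
open import Data.List.Membership.Propositional using (_∈_)
open import Data.List.Relation.Unary.Unique.Propositional using (Unique)
open import Data.Product using (Σ; _×_; _,_; ∃)
open import Data.Sum using (_⊎_)
open import Relation.Nullary using (¬_)
open import Relation.Binary.PropositionalEquality using (_≡_; _≢_)

record Graph : Set₁ where
  field
    V   : Set
    Adj : V → V → Set
open Graph public

K : ℕ → Graph
K n = record { V = Fin n ; Adj = λ x y → x ≢ y }

_×ᴳ_ : Graph → Graph → Graph
G ×ᴳ H = record
  { V   = V G × V H
  ; Adj = λ { (g , h) (g' , h') → Adj G g g' × Adj H h h' } }

module _ (G : Graph) where
  data Walk : V G → V G → Set where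
    [_]  : (u : V G) → Walk u u
    step : (u : V G) {w v : V G} → Adj G u w → Walk w v → Walk u v

  len : ∀ {u v} → Walk u v → ℕ
  len [ u ]          = zero
  len (step u _ q)   = suc (len q)

  verts : ∀ {u v} → Walk u v → List (V G)
  verts [ u ]        = u ∷ []
  verts (step u _ q) = u ∷ verts q

  IsPath : ∀ {u v} → Walk u v → Set
  IsPath q = Unique (verts q)

  IsShortestPath : ∀ {u v} → Walk u v → Set
  IsShortestPath {u} {v} q = IsPath q × (∀ (w : Walk u v) → len q ≤ len w)

  IsFTMV : ℕ → List (V G) → Set
  IsFTMV k X =
    Unique X ×
    (∀ u v → u ∈ X → v ∈ X → u ≢ v → ¬ Adj G u v →
      Σ (Fin (suc k) → Walk u v) λ Q →
        (∀ i → IsShortestPath (Q i)) ×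
        (∀ i j → i ≢ j → ∀ x → x ∈ verts (Q i) → x ∈ verts (Q j) →
           x ≡ u ⊎ x ≡ v) ×
        (∀ i x → x ∈ verts (Q i) → x ∈ X → x ≡ u ⊎ x ≡ v))

  FμIs : ℕ → ℕ → Set
  FμIs k c =
    (∃ λ X → IsFTMV k X × length X ≡ c) ×
    (∀ X → IsFTMV k X → length X ≤ c)

{-# OPTIONS --safe #-}
-- Any two vertices of K_m × K_n have a common neighbour, so a shortest path between
-- non-adjacent vertices has length 2, and X is k-ftmv exactly when every non-adjacent
-- pair u, v of X has k + 1 common neighbours outside X.  Removing k + 4 diagonal cells
-- therefore works: a non-adjacent pair shares a row or a column, so at most three
-- diagonal cells fail to be common neighbours of it.  Conversely, call the cells outside
-- a k-ftmv set X holes.  If every row (or every column) has a hole there are at least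
-- k + 4 holes.  Otherwise, using a full row and a full column of X, three holes in
-- distinct columns yield a non-adjacent pair u, v in X and three holes that are not
-- common neighbours of u and v; together with the k + 1 holes among the common
-- neighbours of u and v these are k + 4 holes.
module Submission where

open import Defs

open import Level using (0ℓ)
open import Data.Nat using (ℕ; zero; suc; _≤_; _+_; _*_; _∸_; z≤n; s≤s)
open import Data.Nat.Properties
open import Data.Fin using (Fin; toℕ; inject≤) renaming (zero to fzero; suc to fsuc)
import Data.Fin.Properties as Fin
open import Data.List using (List; []; _∷_; length; _++_; filter; tabulate; allFin; cartesianProduct; map)
open import Data.List.Properties using (length-++; length-++-sucʳ; length-map; length-tabulate)
open import Data.List.Membership.Propositional using (_∈_; _∉_)
open import Data.List.Membership.Propositional.Properties
open import Data.List.Relation.Binary.Subset.Propositional using (_⊆_)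
open import Data.List.Relation.Binary.Disjoint.Propositional using (Disjoint)
open import Data.List.Relation.Unary.Any using (here; there)
open import Data.List.Relation.Unary.All as All using (All; []; _∷_)
import Data.List.Relation.Unary.All.Properties as All
open import Data.List.Relation.Unary.AllPairs using ([]; _∷_)
open import Data.List.Relation.Unary.Unique.Propositional using (Unique)
import Data.List.Relation.Unary.Unique.Propositional.Properties as Unique
import Data.List.Membership.DecPropositional as DecMembership
open import Data.Product using (Σ; ∃; _×_; _,_; proj₁; proj₂)
open import Data.Product.Properties using (≡-dec)
open import Data.Sum using (_⊎_; inj₁; inj₂; [_,_]′)
open import Data.Empty using (⊥-elim)
open import Function using (_∘_; flip)
open import Function.Definitions using (Injective)
open import Relation.Nullary using (¬_; yes; no; ¬?)
open import Relation.Unary using (Pred; Decidable)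
open import Relation.Binary.Definitions using (DecidableEquality)
open import Relation.Binary.PropositionalEquality
  using (_≡_; _≢_; refl; sym; trans; cong; cong₂; subst; subst₂; ≢-sym; module ≡-Reasoning)

module _ {A : Set} where

  Unique-⊆⇒length≤ : {xs ys : List A} → Unique xs → xs ⊆ ys → length xs ≤ length ys
  Unique-⊆⇒length≤ {[]}     _                   _     = z≤n
  Unique-⊆⇒length≤ {x ∷ xs} (x∉xs ∷ xs-unique) x∷xs⊆ys
    with as , bs , refl ← ∈-∃++ (x∷xs⊆ys (here refl)) = begin
      suc (length xs)          ≤⟨ s≤s (Unique-⊆⇒length≤ xs-unique xs⊆as++bs) ⟩
      suc (length (as ++ bs))  ≡⟨ length-++-sucʳ as x bs ⟨
      length (as ++ x ∷ bs)    ∎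
    where
    open ≤-Reasoning
    xs⊆as++bs : xs ⊆ as ++ bs
    xs⊆as++bs y∈xs with ∈-++⁻ as (x∷xs⊆ys (there y∈xs))
    ... | inj₁ y∈as         = ∈-++⁺ˡ y∈as
    ... | inj₂ (here refl)  = ⊥-elim (All.lookup x∉xs y∈xs refl)
    ... | inj₂ (there y∈bs) = ∈-++⁺ʳ as y∈bs

  length-filter-partition : {P : Pred A 0ℓ} (P? : Decidable P) (xs : List A) →
    length (filter P? xs) + length (filter (¬? ∘ P?) xs) ≡ length xs
  length-filter-partition P? []       = refl
  length-filter-partition P? (x ∷ xs) with P? x
  ... | yes _ = cong suc (length-filter-partition P? xs)
  ... | no  _ = trans (+-suc _ _) (cong suc (length-filter-partition P? xs))

  injectionInto : {xs : List A} {j : ℕ} → Unique xs → j ≤ length xs →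
    Σ (Fin j → A) λ f → Injective _≡_ _≡_ f × (∀ i → f i ∈ xs)
  injectionInto {j = zero} _ _ = (λ ()) , (λ {}) , (λ ())
  injectionInto {x ∷ xs} {suc j} (x∉xs ∷ xs-unique) (s≤s j≤|xs|)
    with g , g-injective , g∈xs ← injectionInto xs-unique j≤|xs| = f , f-injective , f∈x∷xs
    where
    f : Fin (suc j) → A
    f fzero    = x
    f (fsuc i) = g i
    f-injective : Injective _≡_ _≡_ f
    f-injective {fzero}  {fzero}  _  = refl
    f-injective {fzero}  {fsuc i} eq = ⊥-elim (All.lookup x∉xs (g∈xs i) eq)
    f-injective {fsuc i} {fzero}  eq = ⊥-elim (All.lookup x∉xs (g∈xs i) (sym eq))
    f-injective {fsuc i} {fsuc _} eq = cong fsuc (g-injective eq)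
    f∈x∷xs : ∀ i → f i ∈ x ∷ xs
    f∈x∷xs fzero    = here refl
    f∈x∷xs (fsuc i) = there (g∈xs i)

  distinct₃ : {x y z : A} → x ≢ y → x ≢ z → y ≢ z → Unique (x ∷ y ∷ z ∷ [])
  distinct₃ x≢y x≢z y≢z = (x≢y ∷ x≢z ∷ []) ∷ (y≢z ∷ []) ∷ [] ∷ []

module _ {A : Set} (_≟_ : DecidableEquality A) where
  open DecMembership _≟_ using (_∈?_)

  length-filter-∉ : {xs ys : List A} → Unique xs → Unique ys → ys ⊆ xs →
    length ys + length (filter (¬? ∘ (_∈? ys)) xs) ≡ length xs
  length-filter-∉ {xs} {ys} xs-unique ys-unique ys⊆xs =
    trans (cong (_+ length (filter (¬? ∘ (_∈? ys)) xs)) (sym |ys∩xs|≡|ys|)) (length-filter-partition (_∈? ys) xs)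
    where
    |ys∩xs|≡|ys| : length (filter (_∈? ys) xs) ≡ length ys
    |ys∩xs|≡|ys| = ≤-antisym
      (Unique-⊆⇒length≤ (Unique.filter⁺ (_∈? ys) xs-unique) (proj₂ ∘ ∈-filter⁻ (_∈? ys) {xs = xs}))
      (Unique-⊆⇒length≤ ys-unique (λ y∈ys → ∈-filter⁺ (_∈? ys) (ys⊆xs y∈ys) y∈ys))

length-cartesianProduct : {A B : Set} (xs : List A) (ys : List B) →
  length (cartesianProduct xs ys) ≡ length xs * length ys
length-cartesianProduct []       ys = refl
length-cartesianProduct (x ∷ xs) ys = begin
  length (map (x ,_) ys ++ cartesianProduct xs ys)       ≡⟨ length-++ (map (x ,_) ys) ⟩
  length (map (x ,_) ys) + length (cartesianProduct xs ys) ≡⟨ cong₂ _+_ (length-map (x ,_) ys) (length-cartesianProduct xs ys) ⟩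
  length ys + length xs * length ys                      ∎
  where open ≡-Reasoning

avoiding : (L : List ℕ) (N : ℕ) → List (Fin N)
avoiding L N = filter (¬? ∘ (λ t → toℕ t ∈? L)) (allFin N)
  where open DecMembership _≟_ using (_∈?_)

length-avoiding : (L : List ℕ) (N : ℕ) → N ≤ length (avoiding L N) + length L
length-avoiding L N = begin
  N                                        ≡⟨ length-tabulate (λ t → t) ⟨
  length (allFin N)                        ≡⟨ length-filter-partition hits? (allFin N) ⟨
  length hits + length (avoiding L N)      ≤⟨ +-monoˡ-≤ _ |hits|≤|L| ⟩
  length L + length (avoiding L N)         ≡⟨ +-comm (length L) _ ⟩
  length (avoiding L N) + length L         ∎
  where
  open ≤-Reasoning
  open DecMembership _≟_ using (_∈?_)
  hits? : Decidable (λ (t : Fin N) → toℕ t ∈ L)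
  hits? t = toℕ t ∈? L
  hits : List (Fin N)
  hits = filter hits? (allFin N)
  |hits|≤|L| : length hits ≤ length L
  |hits|≤|L| = subst (_≤ length L) (length-map toℕ hits)
    (Unique-⊆⇒length≤ (Unique.map⁺ Fin.toℕ-injective (Unique.filter⁺ hits? (Unique.allFin⁺ N))) hits⊆L)
    where
    hits⊆L : map toℕ hits ⊆ L
    hits⊆L t∈map with _ , t∈hits , refl ← ∈-map⁻ toℕ t∈map = proj₂ (∈-filter⁻ hits? {xs = allFin N} t∈hits)

fresh : {p : ℕ} → 3 ≤ p → (a b : Fin p) → ∃ λ c → a ≢ c × b ≢ c
fresh (s≤s (s≤s (s≤s _))) fzero               fzero               = fsuc fzero , (λ ()) , (λ ())
fresh (s≤s (s≤s (s≤s _))) fzero               (fsuc fzero)        = fsuc (fsuc fzero) , (λ ()) , (λ ())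
fresh (s≤s (s≤s (s≤s _))) fzero               (fsuc (fsuc _))     = fsuc fzero , (λ ()) , (λ ())
fresh (s≤s (s≤s (s≤s _))) (fsuc fzero)        fzero               = fsuc (fsuc fzero) , (λ ()) , (λ ())
fresh (s≤s (s≤s (s≤s _))) (fsuc (fsuc _))     fzero               = fsuc fzero , (λ ()) , (λ ())
fresh (s≤s (s≤s (s≤s _))) (fsuc _)            (fsuc _)            = fzero , (λ ()) , (λ ())

pairUp : {p : ℕ} → 3 ≤ p → (r a : Fin p) → ∃ λ r' → r ≢ r' × (a ≡ r ⊎ a ≡ r')
pairUp 3≤p r a with a Fin.≟ r
... | yes a≡r = proj₁ (fresh 3≤p r r) , proj₁ (proj₂ (fresh 3≤p r r)) , inj₁ a≡r
... | no  a≢r = a , ≢-sym a≢r , inj₂ refl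

module _ (G : Graph) where

  CommonNeighbour : V G → V G → V G → Set
  CommonNeighbour u v w = Adj G u w × Adj G w v

  CommonNeighboursOutside : List (V G) → ℕ → V G → V G → Set
  CommonNeighboursOutside X j u v =
    Σ (Fin j → V G) λ w → Injective _≡_ _≡_ w × (∀ i → w i ∉ X × CommonNeighbour u v (w i))

  VisibilityPaths : ℕ → List (V G) → V G → V G → Set
  VisibilityPaths k X u v =
    Σ (Fin (suc k) → Walk G u v) λ Q →
      (∀ i → IsShortestPath G (Q i)) ×
      (∀ i j → i ≢ j → ∀ x → x ∈ verts G (Q i) → x ∈ verts G (Q j) → x ≡ u ⊎ x ≡ v) ×
      (∀ i x → x ∈ verts G (Q i) → x ∈ X → x ≡ u ⊎ x ≡ v)

  2≤len : ∀ {u v} → u ≢ v → ¬ Adj G u v → (q : Walk G u v) → 2 ≤ len G q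
  2≤len u≢v _   [ _ ]                   = ⊥-elim (u≢v refl)
  2≤len _   u≁v (step _ u~v [ _ ])      = ⊥-elim (u≁v u~v)
  2≤len _   _   (step _ _ (step _ _ _)) = s≤s (s≤s z≤n)

  middle : ∀ {u v} → u ≢ v → ¬ Adj G u v → (q : Walk G u v) → IsPath G q → len G q ≤ 2 →
    Σ (V G) λ w → w ∈ verts G q × CommonNeighbour u v w × ¬ (w ≡ u ⊎ w ≡ v)
  middle u≢v _   [ _ ]                    _ _ = ⊥-elim (u≢v refl)
  middle _   u≁v (step _ u~v [ _ ])       _ _ = ⊥-elim (u≁v u~v)
  middle _   _   (step _ u~w (step w w~v [ _ ])) ((u≢w ∷ _) ∷ (w≢v ∷ []) ∷ _) _ =
    w , there (here refl) , (u~w , w~v) , [ u≢w ∘ sym , w≢v ]′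
  middle _   _   (step _ _ (step _ _ (step _ _ _))) _ (s≤s (s≤s ()))

  -- The walk through w₀ forces every shortest u,v-path to have length 2; the middle
  -- vertices of the k + 1 visibility paths are distinct by internal disjointness.
  ftmv⇒commonNeighboursOutside : ∀ {k X u v w₀} → IsFTMV G k X →
    u ∈ X → v ∈ X → u ≢ v → ¬ Adj G u v → CommonNeighbour u v w₀ →
    CommonNeighboursOutside X (suc k) u v
  ftmv⇒commonNeighboursOutside {k} {X} {u} {v} {w₀} (_ , visible) u∈X v∈X u≢v u≁v (u~w₀ , w₀~v)
    with Q , shortest , disjoint , avoids ← visible u v u∈X v∈X u≢v u≁v =
    w , w-injective , λ i → w∉X i , w-common i
    where
    mid : ∀ i → Σ (V G) λ w → w ∈ verts G (Q i) × CommonNeighbour u v w × ¬ (w ≡ u ⊎ w ≡ v)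
    mid i = middle u≢v u≁v (Q i) (proj₁ (shortest i)) (proj₂ (shortest i) (step u u~w₀ (step w₀ w₀~v [ v ])))
    w : Fin (suc k) → V G
    w i = proj₁ (mid i)
    w∈Q : ∀ i → w i ∈ verts G (Q i)
    w∈Q i = proj₁ (proj₂ (mid i))
    w-common : ∀ i → CommonNeighbour u v (w i)
    w-common i = proj₁ (proj₂ (proj₂ (mid i)))
    w-not-end : ∀ i → ¬ (w i ≡ u ⊎ w i ≡ v)
    w-not-end i = proj₂ (proj₂ (proj₂ (mid i)))
    w∉X : ∀ i → w i ∉ X
    w∉X i w∈X = w-not-end i (avoids i (w i) (w∈Q i) w∈X)
    w-injective : Injective _≡_ _≡_ w
    w-injective {i} {j} wi≡wj with i Fin.≟ j
    ... | yes i≡j = i≡j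
    ... | no  i≢j = ⊥-elim (w-not-end i (disjoint i j i≢j (w i) (w∈Q i) (subst (_∈ verts G (Q j)) (sym wi≡wj) (w∈Q j))))

  commonNeighboursOutside⇒ftmv : ∀ {k X} → Unique X →
    (∀ {u v} → u ∈ X → v ∈ X → u ≢ v → ¬ Adj G u v → CommonNeighboursOutside X (suc k) u v) →
    IsFTMV G k X
  commonNeighboursOutside⇒ftmv {k} {X} X-unique outside =
    X-unique , λ u v u∈X v∈X u≢v u≁v → twoStepPaths u∈X v∈X u≢v u≁v (outside u∈X v∈X u≢v u≁v)
    where
    twoStepPaths : ∀ {u v} → u ∈ X → v ∈ X → u ≢ v → ¬ Adj G u v →
      CommonNeighboursOutside X (suc k) u v → VisibilityPaths k X u v
    twoStepPaths {u} {v} u∈X v∈X u≢v u≁v (w , w-injective , w-outside) = Q , shortest , disjoint , avoids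
      where
      Q : Fin (suc k) → Walk G u v
      Q i = step u (proj₁ (proj₂ (w-outside i))) (step (w i) (proj₂ (proj₂ (w-outside i))) [ v ])
      shortest : ∀ i → IsShortestPath G (Q i)
      shortest i = distinct₃ (λ u≡w → w∉X (subst (_∈ X) u≡w u∈X)) u≢v (λ w≡v → w∉X (subst (_∈ X) (sym w≡v) v∈X)) ,
                   2≤len u≢v u≁v
        where
        w∉X : w i ∉ X
        w∉X = proj₁ (w-outside i)
      disjoint : ∀ i j → i ≢ j → ∀ x → x ∈ verts G (Q i) → x ∈ verts G (Q j) → x ≡ u ⊎ x ≡ v
      disjoint _ _ _   _ (here x≡u)                _                         = inj₁ x≡u
      disjoint _ _ _   _ (there (there (here x≡v))) _                        = inj₂ x≡v
      disjoint _ _ _   _ (there (here _))          (here x≡u)                = inj₁ x≡u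
      disjoint _ _ _   _ (there (here _))          (there (there (here x≡v))) = inj₂ x≡v
      disjoint i j i≢j _ (there (here x≡wi))       (there (here x≡wj))       = ⊥-elim (i≢j (w-injective (trans (sym x≡wi) x≡wj)))
      avoids : ∀ i x → x ∈ verts G (Q i) → x ∈ X → x ≡ u ⊎ x ≡ v
      avoids _ _ (here x≡u)                 _   = inj₁ x≡u
      avoids _ _ (there (there (here x≡v))) _   = inj₂ x≡v
      avoids i _ (there (here refl))        w∈X = ⊥-elim (proj₁ (w-outside i) w∈X)

module _ {m n : ℕ} where

  Adj-sym : ∀ {u v} → Adj (K m ×ᴳ K n) u v → Adj (K m ×ᴳ K n) v u
  Adj-sym (a≢a' , b≢b') = ≢-sym a≢a' , ≢-sym b≢b'

  ¬Adj⇒sameLine : ∀ {a a' b b'} → ¬ Adj (K m ×ᴳ K n) (a , b) (a' , b') → a ≡ a' ⊎ b ≡ b'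
  ¬Adj⇒sameLine {a} {a'} {b} {b'} u≁v with a Fin.≟ a' | b Fin.≟ b'
  ... | yes a≡a' | _        = inj₁ a≡a'
  ... | no  _    | yes b≡b' = inj₂ b≡b'
  ... | no  a≢a' | no  b≢b' = ⊥-elim (u≁v (a≢a' , b≢b'))

  commonNeighbour : 3 ≤ m → 3 ≤ n → ∀ u v → ∃ (CommonNeighbour (K m ×ᴳ K n) u v)
  commonNeighbour 3≤m 3≤n (a , b) (a' , b')
    with c , a≢c , a'≢c ← fresh 3≤m a a'
    with d , b≢d , b'≢d ← fresh 3≤n b b'
    = (c , d) , (a≢c , b≢d) , (≢-sym a'≢c , ≢-sym b'≢d)

  cells : List (Fin m × Fin n)
  cells = cartesianProduct (allFin m) (allFin n)

  ∈-cells : (c : Fin m × Fin n) → c ∈ cells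
  ∈-cells (a , b) = ∈-cartesianProduct⁺ (∈-allFin a) (∈-allFin b)

  cells-unique : Unique cells
  cells-unique = Unique.cartesianProduct⁺ (Unique.allFin⁺ m) (Unique.allFin⁺ n)

  length-cells : length cells ≡ m * n
  length-cells = trans (length-cartesianProduct (allFin m) (allFin n))
    (cong₂ _*_ (length-tabulate {n = m} (λ a → a)) (length-tabulate {n = n} (λ b → b)))

  Unique⇒length≤mn : {xs : List (Fin m × Fin n)} → Unique xs → length xs ≤ m * n
  Unique⇒length≤mn {xs} xs-unique = subst (length xs ≤_) length-cells (Unique-⊆⇒length≤ xs-unique (λ {c} _ → ∈-cells c))

3≤k+4 : ∀ k → 3 ≤ k + 4
3≤k+4 k = ≤-trans (n≤1+n 3) (m≤n+m 4 k)

module UpperBound {k m n : ℕ} (k+4≤m : k + 4 ≤ m) (k+4≤n : k + 4 ≤ n)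
                  {X : List (Fin m × Fin n)} (X-ftmv : IsFTMV (K m ×ᴳ K n) k X) where

  private
    G : Graph
    G = K m ×ᴳ K n
    Cell : Set
    Cell = Fin m × Fin n
    3≤m : 3 ≤ m
    3≤m = ≤-trans (3≤k+4 k) k+4≤m
    3≤n : 3 ≤ n
    3≤n = ≤-trans (3≤k+4 k) k+4≤n

  open DecMembership (≡-dec (Fin._≟_ {m}) (Fin._≟_ {n})) using (_∈?_)

  bound-by-holes : {Z : List Cell} → Unique Z → All (_∉ X) Z → 4 + k ≤ length Z →
    length X ≤ m * n ∸ 4 ∸ k
  bound-by-holes {Z} Z-unique Z-holes 4+k≤|Z| = begin
    length X              ≤⟨ m+n≤o⇒m≤o∸n (length X) |X|+|Z|≤mn ⟩
    m * n ∸ length Z      ≤⟨ ∸-monoʳ-≤ (m * n) 4+k≤|Z| ⟩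
    m * n ∸ (4 + k)       ≡⟨ ∸-+-assoc (m * n) 4 k ⟨
    m * n ∸ 4 ∸ k         ∎
    where
    open ≤-Reasoning
    |X|+|Z|≤mn : length X + length Z ≤ m * n
    |X|+|Z|≤mn = subst (_≤ m * n) (length-++ X)
      (Unique⇒length≤mn (Unique.++⁺ (proj₁ X-ftmv) Z-unique λ (z∈X , z∈Z) → All.lookup Z-holes z∈Z z∈X))

  detours : ∀ {u v} → u ∈ X → v ∈ X → u ≢ v → ¬ Adj G u v → CommonNeighboursOutside G X (suc k) u v
  detours {u} {v} u∈X v∈X u≢v u≁v =
    ftmv⇒commonNeighboursOutside G X-ftmv u∈X v∈X u≢v u≁v (proj₂ (commonNeighbour 3≤m 3≤n u v))

  bound-by-detours : ∀ {u v} → CommonNeighboursOutside G X (suc k) u v →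
    {Z : List Cell} → Unique Z → All (λ z → z ∉ X × ¬ CommonNeighbour G u v z) Z → 3 ≤ length Z →
    length X ≤ m * n ∸ 4 ∸ k
  bound-by-detours (w , w-injective , w-outside) {Z} Z-unique Z-far 3≤|Z| =
    bound-by-holes (Unique.++⁺ (Unique.tabulate⁺ w-injective) Z-unique separated)
                   (All.++⁺ (All.tabulate⁺ (proj₁ ∘ w-outside)) (All.map proj₁ Z-far))
                   size
    where
    separated : Disjoint (tabulate w) Z
    separated (z∈W , z∈Z) with i , refl ← ∈-tabulate⁻ {f = w} z∈W = proj₂ (All.lookup Z-far z∈Z) (proj₂ (w-outside i))
    size : 4 + k ≤ length (tabulate w ++ Z)
    size = begin
      4 + k                          ≡⟨ +-comm 3 (suc k) ⟩
      suc k + 3                      ≤⟨ +-monoʳ-≤ (suc k) 3≤|Z| ⟩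
      suc k + length Z               ≡⟨ cong (_+ length Z) (length-tabulate w) ⟨
      length (tabulate w) + length Z ≡⟨ length-++ (tabulate w) ⟨
      length (tabulate w ++ Z)       ∎
      where open ≤-Reasoning

  pair-bound : ∀ {u v} → u ∈ X → v ∈ X → u ≢ v → ¬ Adj G u v →
    {Z : List Cell} → Unique Z → All (λ z → z ∉ X × ¬ CommonNeighbour G u v z) Z → 3 ≤ length Z →
    length X ≤ m * n ∸ 4 ∸ k
  pair-bound u∈X v∈X u≢v u≁v = bound-by-detours (detours u∈X v∈X u≢v u≁v)

  full-line-or-bound : ∀ {p q} (line : Fin p → Fin q → Cell) →
    (∀ {a a' b b'} → line a b ≡ line a' b' → a ≡ a') → k + 4 ≤ p →
    (∃ λ a → ∀ b → line a b ∈ X) ⊎ length X ≤ m * n ∸ 4 ∸ k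
  full-line-or-bound {p} {q} line line-injective k+4≤p with Fin.any? (λ a → Fin.all? (λ b → line a b ∈? X))
  ... | yes full = inj₁ full
  ... | no ¬full = inj₂ (bound-by-holes (Unique.tabulate⁺ {f = holes} line-injective) (All.tabulate⁺ (proj₂ ∘ hole)) size)
    where
    hole : ∀ a → ∃ λ b → line a b ∉ X
    hole a = Fin.¬∀⟶∃¬ q (λ b → line a b ∈ X) (λ b → line a b ∈? X) (λ full-a → ¬full (a , full-a))
    holes : Fin p → Cell
    holes a = line a (proj₁ (hole a))
    size : 4 + k ≤ length (tabulate holes)
    size = subst₂ _≤_ (+-comm k 4) (sym (length-tabulate holes)) k+4≤p

  module WithFullLines (R : Fin m) (R⊆X : ∀ b → (R , b) ∈ X) (C : Fin n) (C⊆X : ∀ a → (a , C) ∈ X) where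

    hole-off-columns : ∀ {c c'} → c ≢ c' → ∃ λ z → z ∉ X × c ≢ proj₂ z × c' ≢ proj₂ z
    hole-off-columns c≢c'
      with w , _ , w-outside ← detours (R⊆X _) (R⊆X _) (c≢c' ∘ cong proj₂) (λ R≢R → proj₁ R≢R refl)
      with w∉X , (_ , c≢col) , (_ , col≢c') ← w-outside fzero
      = w fzero , w∉X , c≢col , ≢-sym col≢c'

    column-pair-bound : ∀ {c c'} → c ≢ c' → {Z : List Cell} → Unique Z →
      All (λ z → z ∉ X × (proj₂ z ≡ c ⊎ proj₂ z ≡ c')) Z → 3 ≤ length Z → length X ≤ m * n ∸ 4 ∸ k
    column-pair-bound {c} {c'} c≢c' Z-unique Z-in =
      pair-bound (R⊆X c) (R⊆X c') (c≢c' ∘ cong proj₂) (λ R≢R → proj₁ R≢R refl) Z-unique (All.map far Z-in)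
      where
      far : ∀ {z} → z ∉ X × (proj₂ z ≡ c ⊎ proj₂ z ≡ c') → z ∉ X × ¬ CommonNeighbour G (R , c) (R , c') z
      far (z∉X , inj₁ refl) = z∉X , λ ((_ , c≢c) , _) → c≢c refl
      far (z∉X , inj₂ refl) = z∉X , λ (_ , (_ , c'≢c')) → c'≢c' refl

    row-pair-bound : ∀ {r r'} → r ≢ r' → {Z : List Cell} → Unique Z →
      All (λ z → z ∉ X × (proj₁ z ≡ r ⊎ proj₁ z ≡ r')) Z → 3 ≤ length Z → length X ≤ m * n ∸ 4 ∸ k
    row-pair-bound {r} {r'} r≢r' Z-unique Z-in =
      pair-bound (C⊆X r) (C⊆X r') (r≢r' ∘ cong proj₁) (λ C≢C → proj₂ C≢C refl) Z-unique (All.map far Z-in)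
      where
      far : ∀ {z} → z ∉ X × (proj₁ z ≡ r ⊎ proj₁ z ≡ r') → z ∉ X × ¬ CommonNeighbour G (r , C) (r' , C) z
      far (z∉X , inj₁ refl) = z∉X , λ ((r≢r , _) , _) → r≢r refl
      far (z∉X , inj₂ refl) = z∉X , λ (_ , (r'≢r' , _)) → r'≢r' refl

    two-in-row-bound : ∀ {r b b'} → b ≢ b' → (r , b) ∉ X → (r , b') ∉ X →
      ∀ {z} → z ∉ X → b ≢ proj₂ z → b' ≢ proj₂ z → length X ≤ m * n ∸ 4 ∸ k
    two-in-row-bound {r} {b} {b'} b≢b' h h' {a , c} z∉X b≢c b'≢c =
      row-pair-bound (proj₁ (proj₂ (pairUp 3≤m r a))) Z-unique
        ((h , inj₁ refl) ∷ (h' , inj₁ refl) ∷ (z∉X , proj₂ (proj₂ (pairUp 3≤m r a))) ∷ []) ≤-refl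
      where
      Z-unique : Unique ((r , b) ∷ (r , b') ∷ (a , c) ∷ [])
      Z-unique = distinct₃ (b≢b' ∘ cong proj₂) (b≢c ∘ cong proj₂) (b'≢c ∘ cong proj₂)

    -- If two holes share a row, a pair of cells of column C works.  Otherwise the pair
    -- u = (r₁ , c₂), v = (r₁ , c₃) sees hole 1 in its row and holes 2, 3 in its columns,
    -- unless u or v is itself a hole, which then shares a column with hole 2 or 3.
    three-holes-bound : ∀ {r₁ c₁ r₂ c₂ r₃ c₃} → (r₁ , c₁) ∉ X → (r₂ , c₂) ∉ X → (r₃ , c₃) ∉ X →
      c₁ ≢ c₂ → c₁ ≢ c₃ → c₂ ≢ c₃ → length X ≤ m * n ∸ 4 ∸ k
    three-holes-bound {r₁} {c₁} {r₂} {c₂} {r₃} {c₃} h₁ h₂ h₃ c₁≢c₂ c₁≢c₃ c₂≢c₃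
      with r₁ Fin.≟ r₂ | r₁ Fin.≟ r₃ | (r₁ , c₂) ∈? X | (r₁ , c₃) ∈? X
    ... | yes refl | _        | _       | _       = two-in-row-bound c₁≢c₂ h₁ h₂ h₃ c₁≢c₃ c₂≢c₃
    ... | no _     | yes refl | _       | _       = two-in-row-bound c₁≢c₃ h₁ h₃ h₂ c₁≢c₂ (≢-sym c₂≢c₃)
    ... | no r₁≢r₂ | no _     | no h₁₂  | _       =
      column-pair-bound (≢-sym c₁≢c₂)
        (distinct₃ (r₁≢r₂ ∘ cong proj₁) (≢-sym c₁≢c₂ ∘ cong proj₂) (≢-sym c₁≢c₂ ∘ cong proj₂))
        ((h₁₂ , inj₁ refl) ∷ (h₂ , inj₁ refl) ∷ (h₁ , inj₂ refl) ∷ []) ≤-refl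
    ... | no _     | no r₁≢r₃ | yes _   | no h₁₃  =
      column-pair-bound (≢-sym c₁≢c₃)
        (distinct₃ (r₁≢r₃ ∘ cong proj₁) (≢-sym c₁≢c₃ ∘ cong proj₂) (≢-sym c₁≢c₃ ∘ cong proj₂))
        ((h₁₃ , inj₁ refl) ∷ (h₃ , inj₁ refl) ∷ (h₁ , inj₂ refl) ∷ []) ≤-refl
    ... | no _     | no _     | yes u∈X | yes v∈X =
      pair-bound u∈X v∈X (c₂≢c₃ ∘ cong proj₂) (λ (r₁≢r₁ , _) → r₁≢r₁ refl)
        (distinct₃ (c₁≢c₂ ∘ cong proj₂) (c₁≢c₃ ∘ cong proj₂) (c₂≢c₃ ∘ cong proj₂))
        ((h₁ , λ ((r₁≢r₁ , _) , _) → r₁≢r₁ refl) ∷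
         (h₂ , λ ((_ , c₂≢c₂) , _) → c₂≢c₂ refl) ∷
         (h₃ , λ (_ , (_ , c₃≢c₃)) → c₃≢c₃ refl) ∷ []) ≤-refl

    length-X≤ : length X ≤ m * n ∸ 4 ∸ k
    length-X≤
      with (_ , c₁) , h₁ , _ , _           ← hole-off-columns (proj₁ (proj₂ (fresh 3≤n C C)))
      with (_ , c₂) , h₂ , c₁≢c₂ , _       ← hole-off-columns (proj₁ (proj₂ (fresh 3≤n c₁ c₁)))
      with (_ , c₃) , h₃ , c₁≢c₃ , c₂≢c₃   ← hole-off-columns c₁≢c₂
      = three-holes-bound h₁ h₂ h₃ c₁≢c₂ c₁≢c₃ c₂≢c₃

  length-X≤ : length X ≤ m * n ∸ 4 ∸ k
  length-X≤ with full-line-or-bound _,_ (cong proj₁) k+4≤m | full-line-or-bound (flip _,_) (cong proj₂) k+4≤n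
  ... | inj₂ X-small      | _                = X-small
  ... | inj₁ _            | inj₂ X-small     = X-small
  ... | inj₁ (R , R⊆X)    | inj₁ (C , C⊆X)   = WithFullLines.length-X≤ R R⊆X C C⊆X

module LowerBound {k m n : ℕ} (k+4≤m : k + 4 ≤ m) (k+4≤n : k + 4 ≤ n) where

  private
    G : Graph
    G = K m ×ᴳ K n
    Cell : Set
    Cell = Fin m × Fin n

  open DecMembership (≡-dec (Fin._≟_ {m}) (Fin._≟_ {n})) using (_∈?_)

  δ : Fin (k + 4) → Cell
  δ t = inject≤ t k+4≤m , inject≤ t k+4≤n

  δ-injective : Injective _≡_ _≡_ δ
  δ-injective {s} {t} = Fin.inject≤-injective _ _ s t ∘ cong proj₁

  diagonal : List Cell
  diagonal = tabulate δ

  X : List Cell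
  X = filter (¬? ∘ (_∈? diagonal)) cells

  X-unique : Unique X
  X-unique = Unique.filter⁺ (¬? ∘ (_∈? diagonal)) cells-unique

  length-X : length X ≡ m * n ∸ 4 ∸ k
  length-X = begin
    length X                              ≡⟨ m+n∸m≡n (k + 4) (length X) ⟨
    k + 4 + length X ∸ (k + 4)            ≡⟨ cong (λ d → d + length X ∸ (k + 4)) (length-tabulate δ) ⟨
    length diagonal + length X ∸ (k + 4)  ≡⟨ cong (_∸ (k + 4)) |diagonal|+|X|≡mn ⟩
    m * n ∸ (k + 4)                       ≡⟨ cong (m * n ∸_) (+-comm k 4) ⟩
    m * n ∸ (4 + k)                       ≡⟨ ∸-+-assoc (m * n) 4 k ⟨
    m * n ∸ 4 ∸ k                         ∎
    where
    open ≡-Reasoning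
    |diagonal|+|X|≡mn : length diagonal + length X ≡ m * n
    |diagonal|+|X|≡mn = trans
      (length-filter-∉ (≡-dec Fin._≟_ Fin._≟_) cells-unique (Unique.tabulate⁺ δ-injective) (λ {c} _ → ∈-cells c))
      (length-cells {m} {n})

  δ∉X : ∀ t → δ t ∉ X
  δ∉X t δt∈X = proj₂ (∈-filter⁻ (¬? ∘ (_∈? diagonal)) {xs = cells} δt∈X) (∈-tabulate⁺ t)

  Adj-δ : ∀ {a b t} → toℕ a ≢ toℕ t → toℕ b ≢ toℕ t → Adj G (a , b) (δ t)
  Adj-δ {t = t} a≢t b≢t =
    (λ a≡t → a≢t (trans (cong toℕ a≡t) (Fin.toℕ-inject≤ t k+4≤m))) ,
    (λ b≡t → b≢t (trans (cong toℕ b≡t) (Fin.toℕ-inject≤ t k+4≤n)))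

  -- u and v share a row or a column, so their coordinates take at most three values.
  blockers : ∀ {u v} → ¬ Adj G u v →
    Σ (List ℕ) λ L → length L ≡ 3 × (∀ t → toℕ t ∉ L → CommonNeighbour G u v (δ t))
  blockers {a , b} {a' , b'} u≁v with ¬Adj⇒sameLine u≁v
  ... | inj₁ refl = toℕ a ∷ toℕ b ∷ toℕ b' ∷ [] , refl , λ t t∉L →
    Adj-δ (t∉L ∘ here ∘ sym) (t∉L ∘ there ∘ here ∘ sym) ,
    Adj-sym (Adj-δ (t∉L ∘ here ∘ sym) (t∉L ∘ there ∘ there ∘ here ∘ sym))
  ... | inj₂ refl = toℕ a ∷ toℕ a' ∷ toℕ b ∷ [] , refl , λ t t∉L →
    Adj-δ (t∉L ∘ here ∘ sym) (t∉L ∘ there ∘ there ∘ here ∘ sym) ,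
    Adj-sym (Adj-δ (t∉L ∘ there ∘ here ∘ sym) (t∉L ∘ there ∘ there ∘ here ∘ sym))

  suc-k≤|avoiding| : ∀ {L} → length L ≡ 3 → suc k ≤ length (avoiding L (k + 4))
  suc-k≤|avoiding| {L} |L|≡3 = +-cancelʳ-≤ 3 (suc k) _
    (subst₂ _≤_ (+-suc k 3) (cong (length (avoiding L (k + 4)) +_) |L|≡3) (length-avoiding L (k + 4)))

  detours : ∀ {u v} → ¬ Adj G u v → CommonNeighboursOutside G X (suc k) u v
  detours u≁v
    with L , |L|≡3 , avoid⇒common ← blockers u≁v
    with f , f-injective , f∈T ← injectionInto (Unique.filter⁺ _ (Unique.allFin⁺ (k + 4))) (suc-k≤|avoiding| |L|≡3)
    = δ ∘ f , f-injective ∘ δ-injective ,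
      λ i → δ∉X (f i) , avoid⇒common (f i) (proj₂ (∈-filter⁻ _ {xs = allFin (k + 4)} (f∈T i)))

  X-ftmv : IsFTMV G k X
  X-ftmv = commonNeighboursOutside⇒ftmv G X-unique (λ _ _ _ u≁v → detours u≁v)

theorem7p2 : (k m n : ℕ) → k + 5 ≤ m → k + 5 ≤ n →
    FμIs (K m ×ᴳ K n) k (m * n ∸ 4 ∸ k)
theorem7p2 k m n k+5≤m k+5≤n =
  (X , X-ftmv , length-X) , λ Y Y-ftmv → UpperBound.length-X≤ k+4≤m k+4≤n Y-ftmv
  where
  k+4≤m : k + 4 ≤ m
  k+4≤m = ≤-trans (+-monoʳ-≤ k (n≤1+n 4)) k+5≤m
  k+4≤n : k + 4 ≤ n
  k+4≤n = ≤-trans (+-monoʳ-≤ k (n≤1+n 4)) k+5≤n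
  open LowerBound k+4≤m k+4≤n
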